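{- Let $T = (V,E)$ be a finite simple undirected tree. Then $\Xi_T \subseteq \Theta^1_T \subseteq \Theta^0_T$.
   Context: Let $m = |\binom{V}{2}|$. Vectors $x \in \mathbb{R}^m$ have coordinates $x_{uv} = x_{vu}$ indexed by unordered pairs of distinct nodes; for an edge $e = \{u,v\} \in E$ write $x_e = x_{uv}$. $P_{uv}$ is the unique path in $T$ from $u$ to $v$ and $\mathrm{dist}(u,v)$ its number of edges. The path inequalities are $x_{uv} \leq \sum_{e \in P_{uv}} x_e$ and the cut inequalities are $x_e \leq x_{uv}$ for all $e \in P_{uv}$, for all $u,v$ with $\mathrm{dist}(u,v) \geq 2$. $X_T$ is the set of $x \in \{0,1\}^m$ satisfying all path and cut inequalities, $\Xi_T = \operatorname{conv} X_T$, and $\Theta^0_T$ is the set of $x \in [0,1]^m$ satisfying all path and cut inequalities. For $u,v$ with $\mathrm{dist}(u,v) \geq 2$, $\vec{u}(v)$ denotes the neighbor of $u$ on $P_{uv}$ (the first node of $P_{uv}$ different from $u$ and $v$). $\Theta^1_T$ is the set of $x \in [0,1]^m$ such that for all ordered pairs $(u,v)$ with $\mathrm{dist}(u,v) \geq 2$: $x_{uv} \leq x_{u,\vec{u}(v)} + x_{\vec{u}(v),v}$ and $x_{\vec{u}(v),v} \leq x_{uv}$.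
   Formalization: The vectors x have rational rather than real coordinates, and the weights of the convex combinations forming $\Xi_T$ are rational. -}

module Defs where

open import Level using (0ℓ)
open import Data.Nat using (ℕ; suc) renaming (_≤_ to _≤ℕ_)
open import Data.Fin using (Fin)
open import Data.List using (List; []; _∷_; head; last; length; map; foldr)
open import Data.List.Relation.Unary.Linked using (Linked)
open import Data.List.Relation.Unary.All using (All)
open import Data.List.Relation.Unary.Unique.Propositional using (Unique)
open import Data.Maybe using (Maybe; just)
open import Data.Product using (_×_; ∃; Σ)
open import Data.Sum using (_⊎_)
open import Data.Rational using (ℚ; 0ℚ; 1ℚ; _+_; _*_; _≤_)
open import Relation.Binary.PropositionalEquality using (_≡_; _≢_)
open import Relation.Nullary using (¬_)

record Tree (n : ℕ) : Set₁ where
  field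
    Adj     : Fin n → Fin n → Set
    adjSym  : ∀ {u v} → Adj u v → Adj v u
    irrefl  : ∀ {u} → ¬ Adj u u

  IsWalk : Fin n → Fin n → List (Fin n) → Set
  IsWalk u v ps = (head ps ≡ just u) × (last ps ≡ just v) × Linked Adj ps

  IsPath : Fin n → Fin n → List (Fin n) → Set
  IsPath u v ps = IsWalk u v ps × Unique ps

  IsCycle : List (Fin n) → Set
  IsCycle ps = (3 ≤ℕ length ps) × Unique ps × Linked Adj ps
             × ∃ λ a → ∃ λ b → (head ps ≡ just a) × (last ps ≡ just b) × Adj b a

  field
    connected : ∀ u v → ∃ λ ps → IsWalk u v ps
    acyclic   : ∀ ps → ¬ IsCycle ps

-- vectors in ℚ^m, coordinates indexed by pairs; only off-diagonal
-- entries are meaningful, and they must be symmetric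
Coords : ℕ → Set
Coords n = Fin n → Fin n → ℚ

Sym : ∀ {n} → Coords n → Set
Sym {n} x = ∀ (u v : Fin n) → x u v ≡ x v u

pathSum : ∀ {n} → Coords n → List (Fin n) → ℚ
pathSum x []            = 0ℚ
pathSum x (a ∷ [])      = 0ℚ
pathSum x (a ∷ b ∷ ps)  = x a b + pathSum x (b ∷ ps)

data Consec {n : ℕ} : List (Fin n) → Fin n → Fin n → Set where
  here  : ∀ {a b ps} → Consec (a ∷ b ∷ ps) a b
  there : ∀ {c ps a b} → Consec ps a b → Consec (c ∷ ps) a b

module _ {n : ℕ} (T : Tree n) where
  open Tree T

  InUnitCube : Coords n → Set
  InUnitCube x = ∀ u v → u ≢ v → (0ℚ ≤ x u v) × (x u v ≤ 1ℚ)

  IsBinary : Coords n → Set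
  IsBinary x = ∀ u v → u ≢ v → (x u v ≡ 0ℚ) ⊎ (x u v ≡ 1ℚ)

  -- path and cut inequalities, for all u, v with dist(u,v) ≥ 2,
  -- P_uv being the (unique) path from u to v
  PathCut : Coords n → Set
  PathCut x = ∀ u v ps → IsPath u v ps → 3 ≤ℕ length ps →
                (x u v ≤ pathSum x ps)
              × (∀ a b → Consec ps a b → x a b ≤ x u v)

  XT : Coords n → Set
  XT x = Sym x × IsBinary x × PathCut x

  Θ⁰ : Coords n → Set
  Θ⁰ x = Sym x × InUnitCube x × PathCut x

  -- Θ¹_T : for ordered (u,v) with dist ≥ 2, w = u⃗(v) is the second
  -- vertex of P_uv
  Θ¹ : Coords n → Set
  Θ¹ x = Sym x × InUnitCube x ×
         (∀ u w rest v → IsPath u v (u ∷ w ∷ rest) → 3 ≤ℕ length (u ∷ w ∷ rest) →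
            (x u v ≤ x u w + x w v) × (x w v ≤ x u v))

  sumℚ : List ℚ → ℚ
  sumℚ = foldr _+_ 0ℚ

  -- Ξ_T = conv X_T : finite convex combinations of points of X_T
  Ξ : Coords n → Set
  Ξ x = Sym x × ∃ λ (cs : List (ℚ × Coords n)) →
          All (λ c → (0ℚ ≤ Data.Product.proj₁ c) × XT (Data.Product.proj₂ c)) cs
        × (sumℚ (map Data.Product.proj₁ cs) ≡ 1ℚ)
        × (∀ u v → u ≢ v →
             x u v ≡ sumℚ (map (λ c → Data.Product.proj₁ c * Data.Product.proj₂ c u v) cs))

{-# OPTIONS --safe #-}
-- A point of X_T is the cut vector of a partition of V: a pair u, v is cut
-- iff some edge of P_uv is cut (the path inequality gives one direction, the
-- cut inequality the other).  The local inequalities defining Θ¹ hold for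
-- such 0/1 points, and being linear they pass to convex combinations.
-- Conversely, for x ∈ Θ¹, chaining the local cut inequality along P_uv from
-- u bounds x_{av} by x_{uv} for every vertex a of the path, and doing the
-- same from v on the reversed path bounds every edge x_{ab} by x_{av};
-- chaining the local path inequality gives the path inequality.
module Submission where

open import Defs
open import Data.Nat using (ℕ; s≤s) renaming (_≤_ to _≤ℕ_)
open import Data.Nat.Properties using (m≤m+n)
open import Data.Fin using (Fin)
open import Data.List using (List; []; _∷_; head; last; length; map; foldr; reverse; reverseAcc)
open import Data.List.Relation.Unary.Linked as Linked using (Linked; []; [-]; _∷_)
open import Data.List.Relation.Unary.All as All using (All; []; _∷_)
open import Data.List.Relation.Unary.All.Properties using (last⁺)
open import Data.List.Relation.Unary.AllPairs using (AllPairs; []; _∷_)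
open import Data.Maybe using (just)
import Data.Maybe.Relation.Unary.All as Maybe
open import Data.Product using (_×_; _,_; proj₁; proj₂; ∃₂)
open import Data.Sum using (_⊎_; inj₁; inj₂)
open import Data.Empty using (⊥-elim)
open import Data.Rational using (ℚ; 0ℚ; 1ℚ; _+_; _*_; _≤_; nonNegative)
open import Data.Rational.Properties
open import Algebra.Bundles using (CommutativeMonoid)
open import Algebra.Properties.CommutativeSemigroup
  (CommutativeMonoid.commutativeSemigroup +-0-commutativeMonoid) using (interchange)
open import Function using (flip; _∘_)
open import Relation.Binary.PropositionalEquality
open import Relation.Nullary using (¬_)

0≤1 : 0ℚ ≤ 1ℚ
0≤1 = nonNegative⁻¹ 1ℚ

1≰0 : ¬ (1ℚ ≤ 0ℚ)
1≰0 1≤0 = <-irrefl refl (<-≤-trans (positive⁻¹ 1ℚ) 1≤0)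

Bit : ℚ → Set
Bit q = (q ≡ 0ℚ) ⊎ (q ≡ 1ℚ)

bit-nonNeg : ∀ {q} → Bit q → 0ℚ ≤ q
bit-nonNeg (inj₁ refl) = ≤-refl
bit-nonNeg (inj₂ refl) = 0≤1

bit-≤1 : ∀ {q} → Bit q → q ≤ 1ℚ
bit-≤1 (inj₁ refl) = 0≤1
bit-≤1 (inj₂ refl) = ≤-refl

bit-≤ : ∀ {p q} → Bit p → 0ℚ ≤ q → (p ≡ 1ℚ → q ≡ 1ℚ) → p ≤ q
bit-≤ (inj₁ refl) 0≤q _       = 0≤q
bit-≤ (inj₂ refl) _   p≡1⇒q≡1 = ≤-reflexive (sym (p≡1⇒q≡1 refl))

bit-≤-+ : ∀ {p q r} → Bit p → 0ℚ ≤ q → 0ℚ ≤ r → (p ≡ 1ℚ → (q ≡ 1ℚ) ⊎ (r ≡ 1ℚ)) → p ≤ q + r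
bit-≤-+ (inj₁ refl) 0≤q 0≤r _ = ≤-trans (≤-reflexive (sym (+-identityʳ 0ℚ))) (+-mono-≤ 0≤q 0≤r)
bit-≤-+ {q = q} {r} (inj₂ refl) 0≤q 0≤r p≡1⇒ = 1≤q+r (p≡1⇒ refl)
  where
  1≤q+r : (q ≡ 1ℚ) ⊎ (r ≡ 1ℚ) → 1ℚ ≤ q + r
  1≤q+r (inj₁ refl) = ≤-trans (≤-reflexive (sym (+-identityʳ 1ℚ))) (+-monoʳ-≤ 1ℚ 0≤r)
  1≤q+r (inj₂ refl) = ≤-trans (≤-reflexive (sym (+-identityˡ 1ℚ))) (+-monoˡ-≤ 1ℚ 0≤q)

module _ {A : Set} where

  combine : List (ℚ × A) → (A → ℚ) → ℚ
  combine cs f = foldr _+_ 0ℚ (map (λ c → proj₁ c * f (proj₂ c)) cs)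

  combine-const : ∀ cs q → combine cs (λ _ → q) ≡ foldr _+_ 0ℚ (map proj₁ cs) * q
  combine-const []             q = sym (*-zeroˡ q)
  combine-const ((w , _) ∷ cs) q = begin
    w * q + combine cs (λ _ → q)            ≡⟨ cong (w * q +_) (combine-const cs q) ⟩
    w * q + foldr _+_ 0ℚ (map proj₁ cs) * q ≡⟨ *-distribʳ-+ q w _ ⟨
    (w + foldr _+_ 0ℚ (map proj₁ cs)) * q   ∎
    where open ≡-Reasoning

  combine-+ : ∀ cs (f g : A → ℚ) → combine cs (λ a → f a + g a) ≡ combine cs f + combine cs g
  combine-+ []             f g = sym (+-identityʳ 0ℚ)
  combine-+ ((w , a) ∷ cs) f g = begin
    w * (f a + g a) + combine cs (λ a → f a + g a)      ≡⟨ cong₂ _+_ (*-distribˡ-+ w (f a) (g a)) (combine-+ cs f g) ⟩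
    (w * f a + w * g a) + (combine cs f + combine cs g) ≡⟨ interchange (w * f a) (w * g a) _ _ ⟩
    (w * f a + combine cs f) + (w * g a + combine cs g) ∎
    where open ≡-Reasoning

  combine-mono-≤ : ∀ {P : A → Set} {f g : A → ℚ} cs → All (λ c → (0ℚ ≤ proj₁ c) × P (proj₂ c)) cs →
                   (∀ {a} → P a → f a ≤ g a) → combine cs f ≤ combine cs g
  combine-mono-≤ []             []                 f≤g = ≤-refl
  combine-mono-≤ ((w , a) ∷ cs) ((0≤w , Pa) ∷ Pcs) f≤g =
    +-mono-≤ (*-monoˡ-≤-nonNeg w {{nonNegative 0≤w}} (f≤g Pa)) (combine-mono-≤ cs Pcs f≤g)

module _ {A : Set} {R : A → A → Set} where

  Linked-reverseAcc : ∀ {x xs acc} → Linked R (x ∷ xs) → Linked (flip R) (x ∷ acc) →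
                      Linked (flip R) (reverseAcc (x ∷ acc) xs)
  Linked-reverseAcc [-]       Racc = Racc
  Linked-reverseAcc (r ∷ Rxs) Racc = Linked-reverseAcc Rxs (r ∷ Racc)

  Linked-reverse : ∀ {xs} → Linked R xs → Linked (flip R) (reverse xs)
  Linked-reverse {[]}    []  = []
  Linked-reverse {_ ∷ _} Rxs = Linked-reverseAcc Rxs [-]

  module _ (R-sym : ∀ {a b} → R a b → R b a) where

    AllPairs-reverseAcc : ∀ {xs acc} → AllPairs R xs → AllPairs R acc → All (λ x → All (R x) acc) xs →
                          AllPairs R (reverseAcc acc xs)
    AllPairs-reverseAcc []         Racc _                = Racc
    AllPairs-reverseAcc (Rx ∷ Rxs) Racc (Rxacc ∷ Rxsacc) =
      AllPairs-reverseAcc Rxs (Rxacc ∷ Racc) (All.zipWith (λ (r , rs) → R-sym r ∷ rs) (Rx , Rxsacc))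

    AllPairs-reverse : ∀ {xs} → AllPairs R xs → AllPairs R (reverse xs)
    AllPairs-reverse {xs} Rxs = AllPairs-reverseAcc Rxs [] (All.universal (λ _ → []) xs)

module _ {A : Set} where

  head-reverseAcc : ∀ x acc (xs : List A) → head (reverseAcc (x ∷ acc) xs) ≡ last (x ∷ xs)
  head-reverseAcc x acc []       = refl
  head-reverseAcc x acc (y ∷ xs) = head-reverseAcc y (x ∷ acc) xs

  head-reverse : ∀ (xs : List A) → head (reverse xs) ≡ last xs
  head-reverse []       = refl
  head-reverse (x ∷ xs) = head-reverseAcc x [] xs

  last-reverseAcc : ∀ x acc (xs : List A) → last (reverseAcc (x ∷ acc) xs) ≡ last (x ∷ acc)
  last-reverseAcc x acc []       = refl
  last-reverseAcc x acc (y ∷ xs) = last-reverseAcc y (x ∷ acc) xs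

  last-reverse : ∀ (xs : List A) → last (reverse xs) ≡ head xs
  last-reverse []       = refl
  last-reverse (x ∷ xs) = last-reverseAcc x [] xs

  All-last : ∀ {P : A → Set} {xs v} → All P xs → last xs ≡ just v → P v
  All-last {P} Pxs last≡v with subst (Maybe.All P) last≡v (last⁺ Pxs)
  ... | Maybe.just Pv = Pv

Consec-reverseAcc : ∀ {n} {acc : List (Fin n)} {a b} xs → Consec acc a b → Consec (reverseAcc acc xs) a b
Consec-reverseAcc []       ab = ab
Consec-reverseAcc (x ∷ xs) ab = Consec-reverseAcc xs (there ab)

module _ {n : ℕ} (T : Tree n) where
  open Tree T

  adj⇒≢ : ∀ {a b} → Adj a b → a ≢ b
  adj⇒≢ ab refl = irrefl ab

  tail-path : ∀ {u v a w rest} → IsPath u v (a ∷ w ∷ rest) → IsPath w v (w ∷ rest)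
  tail-path ((_ , l , _ ∷ Adj*) , _ ∷ distinct) = (refl , l , Adj*) , distinct

  start-≢-second : ∀ {u v a w rest} → IsPath u v (a ∷ w ∷ rest) → u ≢ w
  start-≢-second ((refl , _) , (u≢w ∷ _) ∷ _) = u≢w

  start-≢-end : ∀ {u v a w rest} → IsPath u v (a ∷ w ∷ rest) → u ≢ v
  start-≢-end ((refl , l , _) , u∉ ∷ _) = All-last u∉ l

  reverse-path : ∀ {u v ps} → IsPath u v ps → IsPath v u (reverse ps)
  reverse-path {ps = ps} ((h , l , Adj*) , distinct) =
    (trans (head-reverse ps) l , trans (last-reverse ps) h , Linked.map adjSym (Linked-reverse Adj*)) ,
    AllPairs-reverse ≢-sym distinct

  LocalPathCut : Coords n → Set
  LocalPathCut x = ∀ u w rest v → IsPath u v (u ∷ w ∷ rest) → 3 ≤ℕ length (u ∷ w ∷ rest) →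
                   (x u v ≤ x u w + x w v) × (x w v ≤ x u v)

  module _ {x : Coords n} (x-sym : Sym x) (local : LocalPathCut x) where

    local-path : ∀ {u v a w c rest} → IsPath u v (a ∷ w ∷ c ∷ rest) → x u v ≤ x u w + x w v
    local-path P@((refl , _) , _) = proj₁ (local _ _ _ _ P (m≤m+n 3 _))

    local-cut : ∀ {u v a w c rest} → IsPath u v (a ∷ w ∷ c ∷ rest) → x w v ≤ x u v
    local-cut P@((refl , _) , _) = proj₂ (local _ _ _ _ P (m≤m+n 3 _))

    start-mono : ∀ {u v a b} ps → IsPath u v ps → Consec ps a b → x a v ≤ x u v
    start-mono _               ((refl , _) , _) here       = ≤-refl
    start-mono (_ ∷ _ ∷ _ ∷ _) P                (there ab) = ≤-trans (start-mono _ (tail-path P) ab) (local-cut P)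
    start-mono (_ ∷ _ ∷ [])    _                (there (there ()))

    first-edge-≤ : ∀ {a b v} rest → IsPath a v (a ∷ b ∷ rest) → x a b ≤ x a v
    first-edge-≤ {a} {b} {v} rest P =
      subst₂ _≤_ (x-sym b a) (x-sym v a) (start-mono _ (reverse-path P) (Consec-reverseAcc rest here))

    edge-≤ : ∀ {u v a b} ps → IsPath u v ps → Consec ps a b → x a b ≤ x u v
    edge-≤ (_ ∷ _ ∷ rest)  P@((refl , _) , _) here       = first-edge-≤ rest P
    edge-≤ (_ ∷ _ ∷ _ ∷ _) P                  (there ab) = ≤-trans (edge-≤ _ (tail-path P) ab) (local-cut P)
    edge-≤ (_ ∷ _ ∷ [])    _                  (there (there ()))

    ≤-pathSum : ∀ {u v a b} rest → IsPath u v (a ∷ b ∷ rest) → x u v ≤ pathSum x (a ∷ b ∷ rest)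
    ≤-pathSum             []      ((refl , refl , _) , _) = ≤-reflexive (sym (+-identityʳ _))
    ≤-pathSum {u} {b = w} (_ ∷ _) P@((refl , _) , _)      =
      ≤-trans (local-path P) (+-monoʳ-≤ (x u w) (≤-pathSum _ (tail-path P)))

    LocalPathCut⇒PathCut : PathCut T x
    LocalPathCut⇒PathCut u v (_ ∷ _ ∷ rest) P _ = ≤-pathSum rest P , λ a b → edge-≤ _ P
    LocalPathCut⇒PathCut u v (_ ∷ [])      _ (s≤s ())

  module _ {y : Coords n} (y∈X : XT T y) where

    bit : ∀ {a b} → a ≢ b → Bit (y a b)
    bit = proj₁ (proj₂ y∈X) _ _

    pathCut : PathCut T y
    pathCut = proj₂ (proj₂ y∈X)

    CutEdge : List (Fin n) → Set
    CutEdge ps = ∃₂ λ a b → Consec ps a b × y a b ≡ 1ℚ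

    cut-edge-of-pathSum : ∀ {ps} → Linked Adj ps → 1ℚ ≤ pathSum y ps → CutEdge ps
    cut-edge-of-pathSum []  1≤0 = ⊥-elim (1≰0 1≤0)
    cut-edge-of-pathSum [-] 1≤0 = ⊥-elim (1≰0 1≤0)
    cut-edge-of-pathSum {a ∷ b ∷ ps} (ab ∷ Adj*) 1≤sum with bit (adj⇒≢ ab)
    ... | inj₂ yab≡1 = a , b , here , yab≡1
    ... | inj₁ yab≡0 =
      let 1≤rest = subst (1ℚ ≤_) (trans (cong (_+ pathSum y (b ∷ ps)) yab≡0) (+-identityˡ _)) 1≤sum
          c , d , cd , ycd≡1 = cut-edge-of-pathSum Adj* 1≤rest
      in  c , d , there cd , ycd≡1

    cut-pair⇒cut-edge : ∀ {u v a b} rest → IsPath u v (a ∷ b ∷ rest) → y u v ≡ 1ℚ → CutEdge (a ∷ b ∷ rest)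
    cut-pair⇒cut-edge                 []             ((refl , refl , _) , _) yuv≡1 = _ , _ , here , yuv≡1
    cut-pair⇒cut-edge {u} {v} {a} {b} rest@(_ ∷ _) P@((_ , _ , Adj*) , _)   yuv≡1 =
      cut-edge-of-pathSum Adj* (subst (_≤ pathSum y (a ∷ b ∷ rest)) yuv≡1 (proj₁ (pathCut u v _ P (m≤m+n 3 _))))

    cut-edge⇒cut-pair : ∀ {u v a b} rest → IsPath u v (a ∷ b ∷ rest) → CutEdge (a ∷ b ∷ rest) → y u v ≡ 1ℚ
    cut-edge⇒cut-pair         []      ((refl , refl , _) , _) (_ , _ , here , yab≡1) = yab≡1
    cut-edge⇒cut-pair         []      _                       (_ , _ , there (there ()) , _)
    cut-edge⇒cut-pair {u} {v} (_ ∷ _) P                       (c , d , cd , ycd≡1)   =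
      ≤-antisym (bit-≤1 (bit (start-≢-end P)))
                (subst (_≤ y u v) ycd≡1 (proj₂ (pathCut u v _ P (m≤m+n 3 _)) c d cd))

    XT⇒LocalPathCut : LocalPathCut y
    XT⇒LocalPathCut u w []      v _ (s≤s (s≤s ()))
    XT⇒LocalPathCut u w (_ ∷ _) v P _ =
      bit-≤-+ (bit u≢v) (bit-nonNeg (bit u≢w)) (bit-nonNeg (bit w≢v)) (split ∘ cut-pair⇒cut-edge _ P) ,
      bit-≤ (bit w≢v) (bit-nonNeg (bit u≢v)) (cut-edge⇒cut-pair _ P ∘ extend ∘ cut-pair⇒cut-edge _ tail)
      where
      tail = tail-path P
      u≢v = start-≢-end P
      u≢w = start-≢-second P
      w≢v = start-≢-end tail

      split : CutEdge (u ∷ w ∷ _) → (y u w ≡ 1ℚ) ⊎ (y w v ≡ 1ℚ)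
      split (_ , _ , here , yuw≡1)     = inj₁ yuw≡1
      split (c , d , there cd , ycd≡1) = inj₂ (cut-edge⇒cut-pair _ tail (c , d , cd , ycd≡1))

      extend : CutEdge (w ∷ _) → CutEdge (u ∷ w ∷ _)
      extend (c , d , cd , ycd≡1) = c , d , there cd , ycd≡1

  Ξ⇒InUnitCube : ∀ {x} → Ξ T x → InUnitCube T x
  Ξ⇒InUnitCube {x} (_ , cs , pts , Σw≡1 , x≡) u v u≢v = 0≤x , x≤1
    where
    open ≤-Reasoning

    0≤x : 0ℚ ≤ x u v
    0≤x = begin
      0ℚ                         ≡⟨ *-zeroʳ (sumℚ T (map proj₁ cs)) ⟨
      sumℚ T (map proj₁ cs) * 0ℚ ≡⟨ combine-const cs 0ℚ ⟨
      combine cs (λ _ → 0ℚ)      ≤⟨ combine-mono-≤ cs pts (λ y∈X → bit-nonNeg (bit y∈X u≢v)) ⟩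
      combine cs (λ y → y u v)   ≡⟨ x≡ u v u≢v ⟨
      x u v                      ∎

    x≤1 : x u v ≤ 1ℚ
    x≤1 = begin
      x u v                      ≡⟨ x≡ u v u≢v ⟩
      combine cs (λ y → y u v)   ≤⟨ combine-mono-≤ cs pts (λ y∈X → bit-≤1 (bit y∈X u≢v)) ⟩
      combine cs (λ _ → 1ℚ)      ≡⟨ combine-const cs 1ℚ ⟩
      sumℚ T (map proj₁ cs) * 1ℚ ≡⟨ *-identityʳ _ ⟩
      sumℚ T (map proj₁ cs)      ≡⟨ Σw≡1 ⟩
      1ℚ                         ∎

  Ξ⇒LocalPathCut : ∀ {x} → Ξ T x → LocalPathCut x
  Ξ⇒LocalPathCut     (_ , _  , _   , _ , _ ) u w []      v _ (s≤s (s≤s ()))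
  Ξ⇒LocalPathCut {x} (_ , cs , pts , _ , x≡) u w (_ ∷ _) v P len = triangle , monotone
    where
    open ≤-Reasoning
    u≢v = start-≢-end P
    u≢w = start-≢-second P
    w≢v = start-≢-end (tail-path P)

    triangle : x u v ≤ x u w + x w v
    triangle = begin
      x u v                                               ≡⟨ x≡ u v u≢v ⟩
      combine cs (λ y → y u v)                            ≤⟨ combine-mono-≤ cs pts (λ y∈X → proj₁ (XT⇒LocalPathCut y∈X u w _ v P len)) ⟩
      combine cs (λ y → y u w + y w v)                    ≡⟨ combine-+ cs (λ y → y u w) (λ y → y w v) ⟩
      combine cs (λ y → y u w) + combine cs (λ y → y w v) ≡⟨ cong₂ _+_ (x≡ u w u≢w) (x≡ w v w≢v) ⟨
      x u w + x w v                                       ∎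

    monotone : x w v ≤ x u v
    monotone = begin
      x w v                    ≡⟨ x≡ w v w≢v ⟩
      combine cs (λ y → y w v) ≤⟨ combine-mono-≤ cs pts (λ y∈X → proj₂ (XT⇒LocalPathCut y∈X u w _ v P len)) ⟩
      combine cs (λ y → y u v) ≡⟨ x≡ u v u≢v ⟨
      x u v                    ∎

lemma4 : ∀ {n : ℕ} (T : Tree n) (x : Coords n) →
         (Ξ T x → Θ¹ T x) × (Θ¹ T x → Θ⁰ T x)
lemma4 T x = (λ x∈Ξ → proj₁ x∈Ξ , Ξ⇒InUnitCube T x∈Ξ , Ξ⇒LocalPathCut T x∈Ξ)
           , (λ (x-sym , cube , local) → x-sym , cube , LocalPathCut⇒PathCut T x-sym local)
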